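{- Let $a_1,a_2,d_1,d_2$ be natural numbers such that the arithmetic progressions $a_1+d_1\mathbb Z_{\ge0}$ and $a_2+d_2\mathbb Z_{\ge0}$ intersect. Let $a\in a_1+d_1\mathbb Z_{\ge0}$ and $b\in a_2+d_2\mathbb Z_{\ge0}$ with $a\neq b$. Then the intersection $(a_1+d_1\mathbb Z_{\ge0})\cap(a_2+d_2\mathbb Z_{\ge0})$ contains infinitely many elements of the progression generated by $a$ and $b$, namely $a+(b-a)\mathbb Z_{\ge0}$ if $a<b$ and $b+(a-b)\mathbb Z_{\ge0}$ if $b<a$. -}

module Defs where

open import Data.Nat using (ℕ; _+_; _*_; _<_)
open import Data.Product using (∃-syntax; _×_)
open import Relation.Binary.PropositionalEquality using (_≡_)

InAP : ℕ → ℕ → ℕ → Set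
InAP a d x = ∃[ k ] x ≡ a + d * k

InfinitelyMany : (ℕ → Set) → Set
InfinitelyMany P = ∀ N → ∃[ x ] (N < x × P x)

-- Let g = gcd d₁ d₂ and D = b − a. A common point of the two progressions makes
-- g divide D, so D = e g; with Bézout g + y d₂ = x d₁ and d₁ = d₁′ g, the step
-- count s = d₁′ x gives D s = e x d₁ = D + e y d₂. Hence a + D s lies in the first
-- progression (it is a plus a multiple of d₁) and in the second (it is b plus a
-- multiple of d₂). Adding multiples of D d₁ d₂ keeps it in all three progressions.
module Submission where

open import Defs
open import Data.Nat using (ℕ; suc; _+_; _*_; _∸_; _<_; NonZero; >-nonZero)
open import Data.Nat.Properties
open import Data.Nat.Divisibility
  using (_∣_; divides; ∣m+n∣m⇒∣n; ∣m∣n⇒∣m+n; ∣m⇒∣m*n; m∣m*n; n∣m*n)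
open import Data.Nat.GCD using (gcd; gcd-GCD; gcd[m,n]∣m; gcd[m,n]∣n; module Bézout)
open import Data.Nat.Tactic.RingSolver using (solve)
open import Data.List.Base using (_∷_; [])
open import Data.Product using (∃-syntax; _×_; _,_)
open import Relation.Binary.PropositionalEquality
  using (_≡_; _≢_; refl; sym; trans; cong; subst; module ≡-Reasoning)

inAP-+ : ∀ {a d x m} → InAP a d x → d ∣ m → InAP a d (x + m)
inAP-+ {a} {d} (k , refl) (divides q refl) = k + q , shift
  where
  shift : a + d * k + q * d ≡ a + d * (k + q)
  shift = solve (a ∷ d ∷ k ∷ q ∷ [])

infinitelyMany-on-progression : ∀ {P : ℕ → Set} x L .{{_ : NonZero L}} →
                                (∀ t → P (x + L * t)) → InfinitelyMany P
infinitelyMany-on-progression x L P[x+Lt] N =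
  x + L * suc N , ≤-trans (m≤n*m (suc N) L) (m≤n+m (L * suc N) x) , P[x+Lt] (suc N)

bézout-+- : ∀ {d} m n .{{_ : NonZero m}} .{{_ : NonZero n}} →
            Bézout.Identity d m n → ∃[ x ] ∃[ y ] d + y * n ≡ x * m
bézout-+- m n (Bézout.+- x y eq) = x , y , eq
bézout-+- {d} m n (Bézout.-+ x y eq) = x′ , y′ , +-cancelʳ-≡ (x * m) _ _ balanced
  where
  x′ = n * (x + y) ∸ x
  y′ = m * (x + y) ∸ y
  x+x′ : x + x′ ≡ n * (x + y)
  x+x′ = m+[n∸m]≡n (≤-trans (m≤m+n x y) (m≤n*m (x + y) n))
  y+y′ : y + y′ ≡ m * (x + y)
  y+y′ = m+[n∸m]≡n (≤-trans (m≤n+m y x) (m≤n*m (x + y) m))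
  open ≡-Reasoning
  balanced : d + y′ * n + x * m ≡ x′ * m + x * m
  balanced = begin
    d + y′ * n + x * m   ≡⟨ cong (_+ x * m) (+-comm d (y′ * n)) ⟩
    y′ * n + d + x * m   ≡⟨ +-assoc (y′ * n) d (x * m) ⟩
    y′ * n + (d + x * m) ≡⟨ cong (y′ * n +_) eq ⟩
    y′ * n + y * n       ≡⟨ *-distribʳ-+ n y′ y ⟨
    (y′ + y) * n         ≡⟨ cong (_* n) (trans (+-comm y′ y) y+y′) ⟩
    m * (x + y) * n      ≡⟨ solve (m ∷ n ∷ x ∷ y ∷ []) ⟩
    n * (x + y) * m      ≡⟨ cong (_* m) x+x′ ⟨
    (x + x′) * m         ≡⟨ *-distribʳ-+ m x x′ ⟩
    x * m + x′ * m       ≡⟨ +-comm (x * m) (x′ * m) ⟩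
    x′ * m + x * m       ∎

common-divisor-∣-gap : ∀ {a₁ a₂ d₁ d₂ c a D m} → m ∣ d₁ → m ∣ d₂ →
                       InAP a₁ d₁ c → InAP a₂ d₂ c →
                       InAP a₁ d₁ a → InAP a₂ d₂ (a + D) → m ∣ D
common-divisor-∣-gap {a₁} {a₂} {d₁} {d₂} {D = D} {m} m∣d₁ m∣d₂
                     (p , refl) (q , c≡) (k , refl) (l , a+D≡) =
  ∣m+n∣m⇒∣n (subst (m ∣_) balance (∣m∣n⇒∣m+n (∣m⇒∣m*n p m∣d₁) (∣m⇒∣m*n l m∣d₂)))
            (∣m∣n⇒∣m+n (∣m⇒∣m*n k m∣d₁) (∣m⇒∣m*n q m∣d₂))
  where
  open ≡-Reasoning
  balance : d₁ * p + d₂ * l ≡ d₁ * k + d₂ * q + D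
  balance = +-cancelˡ-≡ a₁ _ _ (begin
    a₁ + (d₁ * p + d₂ * l)      ≡⟨ +-assoc a₁ (d₁ * p) (d₂ * l) ⟨
    a₁ + d₁ * p + d₂ * l        ≡⟨ cong (_+ d₂ * l) c≡ ⟩
    a₂ + d₂ * q + d₂ * l        ≡⟨ solve (a₂ ∷ d₂ ∷ q ∷ l ∷ []) ⟩
    a₂ + d₂ * l + d₂ * q        ≡⟨ cong (_+ d₂ * q) a+D≡ ⟨
    a₁ + d₁ * k + D + d₂ * q    ≡⟨ solve (a₁ ∷ d₁ ∷ k ∷ D ∷ d₂ ∷ q ∷ []) ⟩
    a₁ + (d₁ * k + d₂ * q + D)  ∎)

bézout-step-reaches-both : ∀ {a₁ a₂ d₁ d₂ a D g x y} →
                           g + y * d₂ ≡ x * d₁ → g ∣ d₁ → g ∣ D →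
                           InAP a₁ d₁ a → InAP a₂ d₂ (a + D) →
                           ∃[ s ] (InAP a₁ d₁ (a + D * s) × InAP a₂ d₂ (a + D * s))
bézout-step-reaches-both {a₂ = a₂} {d₂ = d₂} {a} {g = g} {x} {y}
                         bez (divides d₁′ refl) (divides e refl) ha hb =
  d₁′ * x , inAP-+ ha (divides (e * x) multiple)
          , subst (InAP a₂ d₂) reached (inAP-+ {a₂} {d₂} hb (m∣m*n (e * y)))
  where
  multiple : e * g * (d₁′ * x) ≡ e * x * (d₁′ * g)
  multiple = solve (e ∷ g ∷ d₁′ ∷ x ∷ [])
  open ≡-Reasoning
  reached : a + e * g + d₂ * (e * y) ≡ a + e * g * (d₁′ * x)
  reached = begin
    a + e * g + d₂ * (e * y)   ≡⟨ solve (a ∷ e ∷ g ∷ d₂ ∷ y ∷ []) ⟩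
    a + e * (g + y * d₂)       ≡⟨ cong (λ z → a + e * z) bez ⟩
    a + e * (x * (d₁′ * g))    ≡⟨ solve (a ∷ e ∷ x ∷ d₁′ ∷ g ∷ []) ⟩
    a + e * g * (d₁′ * x)      ∎

intersection-infinite-along :
  ∀ a₁ a₂ d₁ d₂ {c} a D .{{_ : NonZero d₁}} .{{_ : NonZero d₂}} .{{_ : NonZero D}} →
  InAP a₁ d₁ c → InAP a₂ d₂ c → InAP a₁ d₁ a → InAP a₂ d₂ (a + D) →
  InfinitelyMany (λ x → InAP a D x × InAP a₁ d₁ x × InAP a₂ d₂ x)
intersection-infinite-along a₁ a₂ d₁ d₂ a D c₁ c₂ ha hb
  with bézout-+- d₁ d₂ (Bézout.identity (gcd-GCD d₁ d₂))
... | x , y , bez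
  with bézout-step-reaches-both {a₁} {a₂} {d₁} {d₂} {a} {D} {x = x} {y} bez (gcd[m,n]∣m d₁ d₂)
         (common-divisor-∣-gap {a₁} {a₂} {d₁} {d₂} {a = a} {D}
            (gcd[m,n]∣m d₁ d₂) (gcd[m,n]∣n d₁ d₂) c₁ c₂ ha hb) ha hb
... | s , h₁ , h₂ =
  infinitelyMany-on-progression (a + D * s) (D * d₁ * d₂)
    {{m*n≢0 (D * d₁) d₂ {{m*n≢0 D d₁}}}} λ t →
    inAP-+ {a} {D} (s , refl) (∣m⇒∣m*n t (∣m⇒∣m*n d₂ (m∣m*n d₁))) ,
    inAP-+ {a₁} {d₁} h₁ (∣m⇒∣m*n t (∣m⇒∣m*n d₂ (n∣m*n D))) ,
    inAP-+ {a₂} {d₂} h₂ (∣m⇒∣m*n t (n∣m*n (D * d₁)))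

intersection-infinite-along-gap :
  ∀ a₁ a₂ d₁ d₂ {c} a b .{{_ : NonZero d₁}} .{{_ : NonZero d₂}} →
  InAP a₁ d₁ c → InAP a₂ d₂ c → InAP a₁ d₁ a → InAP a₂ d₂ b → a < b →
  InfinitelyMany (λ x → InAP a (b ∸ a) x × InAP a₁ d₁ x × InAP a₂ d₂ x)
intersection-infinite-along-gap a₁ a₂ d₁ d₂ a b c₁ c₂ ha hb a<b =
  intersection-infinite-along a₁ a₂ d₁ d₂ a (b ∸ a) c₁ c₂ ha
    (subst (InAP a₂ d₂) (sym (m+[n∸m]≡n (<⇒≤ a<b))) hb)
  where instance
    b∸a≢0 : NonZero (b ∸ a)
    b∸a≢0 = >-nonZero (m<n⇒0<n∸m a<b)

lemma9 : (a₁ a₂ d₁ d₂ : ℕ) → .{{NonZero d₁}} → .{{NonZero d₂}} →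
    ∃[ c ] (InAP a₁ d₁ c × InAP a₂ d₂ c) →
    (a b : ℕ) → InAP a₁ d₁ a → InAP a₂ d₂ b → a ≢ b →
    (a < b → InfinitelyMany (λ x → InAP a (b ∸ a) x × InAP a₁ d₁ x × InAP a₂ d₂ x))
    × (b < a → InfinitelyMany (λ x → InAP b (a ∸ b) x × InAP a₁ d₁ x × InAP a₂ d₂ x))
lemma9 a₁ a₂ d₁ d₂ (c , c₁ , c₂) a b ha hb _ =
  intersection-infinite-along-gap a₁ a₂ d₁ d₂ a b c₁ c₂ ha hb ,
  λ b<a N → reorder (intersection-infinite-along-gap a₂ a₁ d₂ d₁ b a c₂ c₁ hb ha b<a N)
  where
  reorder : ∀ {N} → ∃[ x ] (N < x × InAP b (a ∸ b) x × InAP a₂ d₂ x × InAP a₁ d₁ x) →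
                    ∃[ x ] (N < x × InAP b (a ∸ b) x × InAP a₁ d₁ x × InAP a₂ d₂ x)
  reorder (x , N<x , h , h₂ , h₁) = x , N<x , h , h₁ , h₂
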